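{- Let $\pi$ be a degree sequence of length $n$ and let $d$ be an integer such that each of the values $1, 2, d, d+1$ occurs exactly once in $\pi$, the value $3$ occurs at least once, and there are exactly three bad degrees, namely $2$, $3$ and $d+1$. If $d \ge n-3$, then $\pi$ is ds-reconstruction-forcing.
   Context: All graphs are finite and simple. A degree $d$ of a sequence is bad if $d-1$ also occurs in the sequence. A vertex $v$ of a graph $G$ is ds-completable if, for each integer $d$, the vertices having degree $d$ in $G-v$ are either all neighbours of $v$ in $G$ or all non-neighbours. A graph is ds-reconstructible if it has a ds-completable vertex; a degree sequence is ds-reconstruction-forcing if every graph realizing it is ds-reconstructible (non-graphic sequences are deemed forcing). -}

module Defs where

open import Data.Nat using (ℕ; zero; suc; _+_; _≤_; _≟_)
open import Data.Bool using (Bool; true; false; if_then_else_)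
open import Data.Fin using (Fin)
import Data.Fin as F
open import Data.List using (List; []; _∷_; map; length; filter)
open import Data.List.Base using (allFin)
open import Data.List.Membership.Propositional using (_∈_)
open import Data.List.Relation.Binary.Permutation.Propositional using (_↭_)
open import Data.Product using (Σ; _×_; ∃-syntax)
open import Data.Sum using (_⊎_)
open import Relation.Nullary using (¬_; does)
open import Relation.Binary.PropositionalEquality using (_≡_; _≢_)

countB : {A : Set} → (A → Bool) → List A → ℕ
countB p []       = zero
countB p (x ∷ xs) = if p x then suc (countB p xs) else countB p xs

record Graph (n : ℕ) : Set where
  field
    adj     : Fin n → Fin n → Bool
    sym     : ∀ u w → adj u w ≡ adj w u
    irrefl  : ∀ u → adj u u ≡ false
open Graph public

deg : {n : ℕ} → Graph n → Fin n → ℕ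
deg {n} G u = countB (adj G u) (allFin n)

-- degree of u (u ≠ v) in G - v : neighbours of u other than v
degDel : {n : ℕ} → Graph n → Fin n → Fin n → ℕ
degDel {n} G v u =
  countB (λ w → if does (w F.≟ v) then false else adj G u w) (allFin n)

degSeq : {n : ℕ} → Graph n → List ℕ
degSeq {n} G = map (deg G) (allFin n)

Realizes : (π : List ℕ) → Graph (length π) → Set
Realizes π G = degSeq G ↭ π

DsCompletable : {n : ℕ} → Graph n → Fin n → Set
DsCompletable G v =
  ∀ (d : ℕ) →
    (∀ u → u ≢ v → degDel G v u ≡ d → adj G v u ≡ true)
    ⊎ (∀ u → u ≢ v → degDel G v u ≡ d → adj G v u ≡ false)

DsReconstructible : {n : ℕ} → Graph n → Set
DsReconstructible {n} G = Σ (Fin n) λ v → DsCompletable G v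

-- every graph realizing π is ds-reconstructible
-- (vacuous for non-graphic π, matching the convention)
DsReconstructionForcing : List ℕ → Set
DsReconstructionForcing π =
  (G : Graph (length π)) → Realizes π G → DsReconstructible G

occ : ℕ → List ℕ → ℕ
occ k π = countB (λ x → does (x ≟ k)) π

Bad : List ℕ → ℕ → Set
Bad π x = x ∈ π × (Σ ℕ λ y → y ∈ π × suc y ≡ x)

module Submission where

-- Deleting a vertex v lowers the degree of its neighbours by one
-- and keeps that of its non-neighbours, so a neighbour u and a non-neighbour t
-- of v get the same degree in G - v exactly when deg u = deg t + 1.  Hence v
-- is ds-completable as soon as no such "step" u, t exists around v
-- (stepFree⇒completable), and deg u is then a bad degree: 2, 3 or d + 1.
-- Let w be the vertex of degree d + 1; as n ≤ d + 3, w has at most one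
-- non-neighbour x.  If there is none, or deg x ∉ {1, 2}, w is step-free; if
-- deg x = 2, x is.  If deg x = 1 with neighbour u₀, then x is step-free unless
-- deg u₀ = 3; in that case the vertex b of degree 2 is step-free if it is
-- adjacent to the vertex z of degree d, and otherwise u₀ is, by counting the
-- neighbours of u₀ and the non-neighbours of z.

open import Defs hiding (sym)
open import Data.Nat using (ℕ; suc; _+_; _≤_; z≤n; s≤s)
import Data.Nat as ℕ
open import Data.Nat.Properties using (+-suc; +-monoʳ-≤; +-commutativeSemigroup; <-irrefl; ≤-trans; 0≢1+n; 1+n≢n; suc-injective; ≡ᵇ⇒≡)
open import Algebra.Properties.CommutativeSemigroup +-commutativeSemigroup using (x∙yz≈y∙xz)
open import Data.Bool using (Bool; true; false; if_then_else_; not)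
open import Data.Bool.Properties using (T-≡) renaming (_≟_ to _≟ᵇ_)
open import Data.Fin using (Fin)
import Data.Fin as F
import Data.Fin.Properties as F
open import Data.List using (List; []; _∷_; map; length)
open import Data.List.Base using (allFin)
open import Data.List.Properties using (map-tabulate; length-tabulate)
open import Data.List.Relation.Unary.All using (All; []; _∷_)
import Data.List.Relation.Unary.All as All
open import Data.List.Relation.Unary.Unique.Propositional using (Unique; []; _∷_)
open import Data.List.Relation.Binary.Permutation.Propositional as ↭ using (_↭_)
open import Data.Product using (Σ; _×_; _,_; proj₁; proj₂)
open import Data.Sum using (_⊎_; inj₁; inj₂)
open import Data.Empty using (⊥-elim)
open import Function using (_∘_; id)
open import Function.Bundles using (_⇔_; Equivalence)
open import Data.List.Membership.Propositional using (_∈_)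
open import Data.List.Membership.Propositional.Properties using (∈-map⁺; ∈-allFin)
open import Data.List.Relation.Binary.Permutation.Propositional.Properties using (∈-resp-↭)
open import Relation.Nullary using (¬_; does; yes; no)
open import Relation.Nullary.Decidable using (¬?; _×-dec_; dec-true)
open import Relation.Binary.PropositionalEquality

bit : Bool → ℕ
bit true  = 1
bit false = 0

true≢false : true ≢ false
true≢false ()

module _ {A : Set} where

  countB-∷ : (p : A → Bool) (x : A) (xs : List A) →
             countB p (x ∷ xs) ≡ bit (p x) + countB p xs
  countB-∷ p x xs with p x
  ... | true  = refl
  ... | false = refl

  countB-↭ : (p : A → Bool) {xs ys : List A} → xs ↭ ys → countB p xs ≡ countB p ys
  countB-↭ p ↭.refl = refl
  countB-↭ p (↭.prep x r) with p x
  ... | true  = cong suc (countB-↭ p r)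
  ... | false = countB-↭ p r
  countB-↭ p (↭.swap x y r) with p x | p y
  ... | true  | true  = cong (suc ∘ suc) (countB-↭ p r)
  ... | true  | false = cong suc (countB-↭ p r)
  ... | false | true  = cong suc (countB-↭ p r)
  ... | false | false = countB-↭ p r
  countB-↭ p (↭.trans r s) = trans (countB-↭ p r) (countB-↭ p s)

  countB-complement : (p : A → Bool) (xs : List A) →
                      countB p xs + countB (not ∘ p) xs ≡ length xs
  countB-complement p [] = refl
  countB-complement p (x ∷ xs) with p x
  ... | true  = cong suc (countB-complement p xs)
  ... | false = trans (+-suc (countB p xs) _) (cong suc (countB-complement p xs))

  countB-witness : (p : A → Bool) (xs : List A) → countB p xs ≢ 0 → Σ A λ x → p x ≡ true
  countB-witness p [] c≢0 = ⊥-elim (c≢0 refl)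
  countB-witness p (x ∷ xs) c≢0 with p x in px
  ... | true  = x , px
  ... | false = countB-witness p xs c≢0

countB-map : {A B : Set} (p : B → Bool) (f : A → B) (xs : List A) →
             countB p (map f xs) ≡ countB (p ∘ f) xs
countB-map p f [] = refl
countB-map p f (x ∷ xs) with p (f x)
... | true  = cong suc (countB-map p f xs)
... | false = countB-map p f xs

countB-allFin-suc : {n : ℕ} (q : Fin (suc n) → Bool) →
                    countB q (allFin (suc n)) ≡ bit (q F.zero) + countB (q ∘ F.suc) (allFin n)
countB-allFin-suc {n} q = begin
  countB q (allFin (suc n))                        ≡⟨ cong (countB q ∘ (F.zero ∷_)) (sym (map-tabulate id F.suc)) ⟩
  countB q (F.zero ∷ map F.suc (allFin n))         ≡⟨ countB-∷ q F.zero (map F.suc (allFin n)) ⟩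
  bit (q F.zero) + countB q (map F.suc (allFin n)) ≡⟨ cong (bit (q F.zero) +_) (countB-map q F.suc (allFin n)) ⟩
  bit (q F.zero) + countB (q ∘ F.suc) (allFin n)   ∎
  where open ≡-Reasoning

except : {n : ℕ} → (Fin n → Bool) → Fin n → Fin n → Bool
except q v w = if does (w F.≟ v) then false else q w

except-≢ : {n : ℕ} (q : Fin n → Bool) {v w : Fin n} → v ≢ w → except q v w ≡ q w
except-≢ q {v} {w} v≢w with w F.≟ v
... | yes w≡v = ⊥-elim (v≢w (sym w≡v))
... | no  _   = refl

-- Each point of Fin n occurs exactly once in allFin n, so removing v from the
-- test lowers the count by exactly  bit (q v).
countB-except : {n : ℕ} (q : Fin n → Bool) (v : Fin n) →
                countB q (allFin n) ≡ bit (q v) + countB (except q v) (allFin n)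
countB-except q F.zero =
  trans (countB-allFin-suc q) (cong (bit (q F.zero) +_) (sym (countB-allFin-suc (except q F.zero))))
countB-except q (F.suc v) = begin
  countB q (allFin _)                                          ≡⟨ countB-allFin-suc q ⟩
  bit (q F.zero) + countB (q ∘ F.suc) (allFin _)               ≡⟨ cong (bit (q F.zero) +_) (countB-except (q ∘ F.suc) v) ⟩
  bit (q F.zero) + (bit (q (F.suc v)) + countB (except (q ∘ F.suc) v) (allFin _))
                                                               ≡⟨ x∙yz≈y∙xz (bit (q F.zero)) (bit (q (F.suc v))) _ ⟩
  bit (q (F.suc v)) + (bit (q F.zero) + countB (except (q ∘ F.suc) v) (allFin _))
                                                               ≡⟨ cong (bit (q (F.suc v)) +_) (sym (countB-allFin-suc (except q (F.suc v)))) ⟩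
  bit (q (F.suc v)) + countB (except q (F.suc v)) (allFin _)   ∎
  where open ≡-Reasoning

unique-≤-countB : {n : ℕ} (q : Fin n → Bool) {ys : List (Fin n)} →
                  Unique ys → All (λ y → q y ≡ true) ys → length ys ≤ countB q (allFin n)
unique-≤-countB q [] [] = z≤n
unique-≤-countB q {y ∷ ys} (y∉ys ∷ uys) (qy ∷ qys)
  rewrite countB-except q y | qy =
    s≤s (unique-≤-countB (except q y) uys (All.zipWith passes (y∉ys , qys)))
  where
    passes : {w : Fin _} → y ≢ w × q w ≡ true → except q y w ≡ true
    passes (y≢w , qw) = trans (except-≢ q y≢w) qw

countB-one-unique : {n : ℕ} (q : Fin n → Bool) → countB q (allFin n) ≡ 1 →
                    {u u' : Fin n} → q u ≡ true → q u' ≡ true → u ≡ u'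
countB-one-unique q c≡1 {u} {u'} qu qu' with u F.≟ u'
... | yes u≡u' = u≡u'
... | no  u≢u' = ⊥-elim (<-irrefl refl
                   (subst (2 ≤_) c≡1 (unique-≤-countB q ((u≢u' ∷ []) ∷ [] ∷ []) (qu ∷ qu' ∷ []))))

module _ {n : ℕ} (G : Graph n) where

  adj-sym : {u w : Fin n} {b : Bool} → adj G u w ≡ b → adj G w u ≡ b
  adj-sym {u} {w} e = trans (Graph.sym G w u) e

  deg-degDel : (v u : Fin n) → deg G u ≡ bit (adj G u v) + degDel G v u
  deg-degDel v u = countB-except (adj G u) v

  deg-neighbour : {v u : Fin n} → adj G v u ≡ true → deg G u ≡ suc (degDel G v u)
  deg-neighbour {v} {u} vu rewrite deg-degDel v u | adj-sym vu = refl

  deg-nonNeighbour : {v u : Fin n} → adj G v u ≡ false → deg G u ≡ degDel G v u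
  deg-nonNeighbour {v} {u} vu rewrite deg-degDel v u | adj-sym vu = refl

  neighbours-bound : (v : Fin n) {ys : List (Fin n)} → Unique ys →
                     All (λ y → adj G v y ≡ true) ys → length ys ≤ deg G v
  neighbours-bound v = unique-≤-countB (adj G v)

  nonNeighbours-bound : (v : Fin n) {ys : List (Fin n)} → Unique ys →
                        All (λ y → adj G v y ≡ false) ys → deg G v + length ys ≤ n
  nonNeighbours-bound v {ys} uys non =
    subst (deg G v + length ys ≤_) total
      (+-monoʳ-≤ (deg G v) (unique-≤-countB (not ∘ adj G v) uys (All.map (cong not) non)))
    where
      total : countB (adj G v) (allFin n) + countB (not ∘ adj G v) (allFin n) ≡ n
      total = trans (countB-complement (adj G v) (allFin n)) (length-tabulate id)

  -- v is step-free if no neighbour of v has degree one more than a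
  -- non-neighbour of v; these are the only pairs that deleting v can merge.
  StepFree : Fin n → Set
  StepFree v = ∀ u t → u ≢ v → t ≢ v → adj G v u ≡ true → adj G v t ≡ false →
               deg G u ≢ suc (deg G t)

  -- In G - v a neighbour u and a non-neighbour t of v have equal degree
  -- exactly when deg u = deg t + 1; so a step-free vertex is ds-completable.
  stepFree⇒completable : (v : Fin n) → StepFree v → DsCompletable G v
  stepFree⇒completable v free D
    with F.any? (λ u → ¬? (u F.≟ v) ×-dec (degDel G v u ℕ.≟ D) ×-dec (adj G v u ≟ᵇ true))
  ... | yes (u , u≢v , du , vu) = inj₁ allNeighbours
    where
      allNeighbours : ∀ t → t ≢ v → degDel G v t ≡ D → adj G v t ≡ true
      allNeighbours t t≢v dt with adj G v t in vt
      ... | true  = refl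
      ... | false = ⊥-elim (free u t u≢v t≢v vu vt (begin
        deg G u              ≡⟨ deg-neighbour vu ⟩
        suc (degDel G v u)   ≡⟨ cong suc (trans du (sym dt)) ⟩
        suc (degDel G v t)   ≡⟨ cong suc (sym (deg-nonNeighbour vt)) ⟩
        suc (deg G t)        ∎))
        where open ≡-Reasoning
  ... | no noNeighbour = inj₂ allNonNeighbours
    where
      allNonNeighbours : ∀ t → t ≢ v → degDel G v t ≡ D → adj G v t ≡ false
      allNonNeighbours t t≢v dt with adj G v t in vt
      ... | true  = ⊥-elim (noNeighbour (t , t≢v , dt , vt))
      ... | false = refl

  stepFree⇒reconstructible : (v : Fin n) → StepFree v → DsReconstructible G
  stepFree⇒reconstructible v free = v , stepFree⇒completable v free

module Forcing
  (π : List ℕ) (d : ℕ)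
  (once₁ : occ 1 π ≡ 1) (once₂ : occ 2 π ≡ 1) (onceD : occ d π ≡ 1) (onceD+1 : occ (suc d) π ≡ 1)
  (bad : ∀ x → Bad π x ⇔ (x ≡ 2 ⊎ x ≡ 3 ⊎ x ≡ suc d))
  (d+1≢2 : suc d ≢ 2) (d+1≢3 : suc d ≢ 3)
  (short : length π ≤ d + 3)
  (G : Graph (length π)) (realizes : Realizes π G)
  where

  Vertex : Set
  Vertex = Fin (length π)

  hasDeg : ℕ → Vertex → Bool
  hasDeg k u = does (deg G u ℕ.≟ k)

  count-hasDeg : (k : ℕ) → countB (hasDeg k) (allFin (length π)) ≡ occ k π
  count-hasDeg k = trans (sym (countB-map (λ x → does (x ℕ.≟ k)) (deg G) (allFin _)))
                         (countB-↭ _ realizes)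

  hasDeg-sound : {k : ℕ} (u : Vertex) → hasDeg k u ≡ true → deg G u ≡ k
  hasDeg-sound {k} u e = ≡ᵇ⇒≡ (deg G u) k (Equivalence.from T-≡ e)

  vertexOfDeg : (k : ℕ) → occ k π ≡ 1 → Σ Vertex λ u → deg G u ≡ k
  vertexOfDeg k once with countB-witness (hasDeg k) (allFin _)
                           (λ c≡0 → 0≢1+n (trans (sym c≡0) (trans (count-hasDeg k) once)))
  ... | u , du = u , hasDeg-sound u du

  uniqueOfDeg : {k : ℕ} → occ k π ≡ 1 → {u u' : Vertex} → deg G u ≡ k → deg G u' ≡ k → u ≡ u'
  uniqueOfDeg {k} once du du' =
    countB-one-unique (hasDeg k) (trans (count-hasDeg k) once) (dec-true (_ ℕ.≟ k) du) (dec-true (_ ℕ.≟ k) du')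

  step-bad : {u t : Vertex} → deg G u ≡ suc (deg G t) → deg G u ≡ 2 ⊎ deg G u ≡ 3 ⊎ deg G u ≡ suc d
  step-bad {u} {t} step = Equivalence.to (bad (deg G u)) (occurs u , deg G t , occurs t , sym step)
    where
      occurs : (v : Vertex) → deg G v ∈ π
      occurs v = ∈-resp-↭ realizes (∈-map⁺ (deg G) (∈-allFin v))

  no-room : ¬ (suc (d + 3) ≤ length π)
  no-room big = <-irrefl refl (≤-trans big short)

  distinctByDeg : {u v : Vertex} {k m : ℕ} → deg G u ≡ k → deg G v ≡ m → k ≢ m → u ≢ v
  distinctByDeg du dv k≢m u≡v = k≢m (trans (sym du) (trans (cong (deg G) u≡v) dv))

  d≢1 : d ≢ 1
  d≢1 = d+1≢2 ∘ cong suc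

  d≢2 : d ≢ 2
  d≢2 = d+1≢3 ∘ cong suc

  b z w : Vertex
  b = proj₁ (vertexOfDeg 2 once₂)
  z = proj₁ (vertexOfDeg d onceD)
  w = proj₁ (vertexOfDeg (suc d) onceD+1)

  deg-b : deg G b ≡ 2
  deg-b = proj₂ (vertexOfDeg 2 once₂)
  deg-z : deg G z ≡ d
  deg-z = proj₂ (vertexOfDeg d onceD)
  deg-w : deg G w ≡ suc d
  deg-w = proj₂ (vertexOfDeg (suc d) onceD+1)

  w≢z : w ≢ z
  w≢z = distinctByDeg deg-w deg-z 1+n≢n

  -- The case where w has a non-neighbour x; since n ≤ d + 3 it is the only one.
  module NonNeighbour (x : Vertex) (x≢w : x ≢ w) (wx : adj G w x ≡ false) where

    -- Otherwise w, x, y are d + 4 vertices in G, as deg w = d + 1.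
    only-nonNeighbour : {y : Vertex} → y ≢ w → adj G w y ≡ false → y ≡ x
    only-nonNeighbour {y} y≢w wy with y F.≟ x
    ... | yes y≡x = y≡x
    ... | no  y≢x = ⊥-elim (no-room (subst (λ k → k + 3 ≤ length π) deg-w
            (nonNeighbours-bound G w ((≢-sym x≢w ∷ ≢-sym y≢w ∷ []) ∷ (≢-sym y≢x ∷ []) ∷ [] ∷ [])
                                     (Graph.irrefl G w ∷ wx ∷ wy ∷ []))))

    -- A step across w ends at its non-neighbour x, so deg x ∈ {1, 2}.
    w-stepFree : deg G x ≢ 1 → deg G x ≢ 2 → StepFree G w
    w-stepFree dx≢1 dx≢2 u t u≢w t≢w _ wt step with only-nonNeighbour t≢w wt
    ... | refl with step-bad step
    ...   | inj₁ du≡2        = dx≢1 (suc-injective (trans (sym step) du≡2))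
    ...   | inj₂ (inj₁ du≡3) = dx≢2 (suc-injective (trans (sym step) du≡3))
    ...   | inj₂ (inj₂ du≡w) = u≢w (uniqueOfDeg onceD+1 du≡w deg-w)

    -- If deg x = 2 then x is the unique vertex of degree 2 and is not adjacent to w.
    x-stepFree-deg2 : deg G x ≡ 2 → StepFree G x
    x-stepFree-deg2 dx u t u≢x t≢x xu _ step with step-bad step
    ... | inj₁ du≡2        = u≢x (uniqueOfDeg once₂ du≡2 dx)
    ... | inj₂ (inj₁ du≡3) = t≢x (uniqueOfDeg once₂ (suc-injective (trans (sym step) du≡3)) dx)
    ... | inj₂ (inj₂ du≡w) with uniqueOfDeg onceD+1 du≡w deg-w
    ...   | refl = true≢false (trans (sym xu) (adj-sym G wx))

    module Leaf (deg-x : deg G x ≡ 1) where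

      u₀ : Vertex
      u₀ = proj₁ (countB-witness (adj G x) (allFin _) (λ c≡0 → 0≢1+n (trans (sym c≡0) deg-x)))

      x-u₀ : adj G x u₀ ≡ true
      x-u₀ = proj₂ (countB-witness (adj G x) (allFin _) (λ c≡0 → 0≢1+n (trans (sym c≡0) deg-x)))

      only-neighbour : {y : Vertex} → adj G x y ≡ true → y ≡ u₀
      only-neighbour xy = countB-one-unique (adj G x) deg-x xy x-u₀

      x≢u₀ : x ≢ u₀
      x≢u₀ x≡u₀ = true≢false (trans (sym x-u₀) (trans (cong (adj G x) (sym x≡u₀)) (Graph.irrefl G x)))

      x≢z : x ≢ z
      x≢z = distinctByDeg deg-x deg-z (d≢1 ∘ sym)

      -- A step across x starts at u₀ and ends at a vertex of degree ≥ 2,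
      -- so it needs deg u₀ = 3.
      x-stepFree : deg G u₀ ≢ 3 → StepFree G x
      x-stepFree du₀≢3 u t u≢x t≢x xu _ step with step-bad step
      ... | inj₁ du≡2        = t≢x (uniqueOfDeg once₁ (suc-injective (trans (sym step) du≡2)) deg-x)
      ... | inj₂ (inj₁ du≡3) = du₀≢3 (trans (cong (deg G) (sym (only-neighbour xu))) du≡3)
      ... | inj₂ (inj₂ du≡w) =
        true≢false (trans (sym xu) (trans (cong (adj G x) (uniqueOfDeg onceD+1 du≡w deg-w)) (adj-sym G wx)))

      -- If b ~ z, a step across b would have to end at z (degree d).
      b-stepFree : adj G b z ≡ true → StepFree G b
      b-stepFree bz u t u≢b t≢b _ bt step with step-bad step
      ... | inj₁ du≡2        = u≢b (uniqueOfDeg once₂ du≡2 deg-b)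
      ... | inj₂ (inj₁ du≡3) = t≢b (uniqueOfDeg once₂ (suc-injective (trans (sym step) du≡3)) deg-b)
      ... | inj₂ (inj₂ du≡w) with uniqueOfDeg onceD (suc-injective (trans (sym step) du≡w)) deg-z
      ...   | refl = true≢false (trans (sym bz) bt)

      module Hub (deg-u₀ : deg G u₀ ≡ 3) (bz : adj G b z ≡ false) where

        -- u₀ ≠ x is a neighbour of w, since x is w's only non-neighbour.
        u₀-w : adj G u₀ w ≡ true
        u₀-w with adj G u₀ w in u₀w
        ... | true  = refl
        ... | false = ⊥-elim (x≢u₀ (sym (only-nonNeighbour u₀≢w (adj-sym G u₀w))))
          where
            u₀≢w : u₀ ≢ w
            u₀≢w = distinctByDeg deg-u₀ deg-w (d+1≢3 ∘ sym)

        -- Otherwise x, b, z, u₀ would be d + 4 ≥ n + 1 vertices not adjacent to z.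
        u₀-z : z ≢ u₀ → adj G u₀ z ≡ true
        u₀-z z≢u₀ with adj G z u₀ in zu₀
        ... | true  = adj-sym G zu₀
        ... | false = ⊥-elim (no-room (subst (_≤ length π) (+-suc d 3) (subst (λ k → k + 4 ≤ length π) deg-z
              (nonNeighbours-bound G z ((x≢b ∷ x≢z ∷ x≢u₀ ∷ []) ∷ (b≢z ∷ b≢u₀ ∷ []) ∷ (z≢u₀ ∷ []) ∷ [] ∷ [])
                                       (z-x ∷ adj-sym G bz ∷ Graph.irrefl G z ∷ zu₀ ∷ [])))))
          where
            x≢b : x ≢ b
            x≢b = distinctByDeg deg-x deg-b (λ ())
            b≢z : b ≢ z
            b≢z = distinctByDeg deg-b deg-z (d≢2 ∘ sym)
            b≢u₀ : b ≢ u₀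
            b≢u₀ = distinctByDeg deg-b deg-u₀ (λ ())
            z-x : adj G z x ≡ false
            z-x with adj G x z in xz
            ... | true  = ⊥-elim (z≢u₀ (only-neighbour xz))
            ... | false = adj-sym G xz

        -- A step across u₀ ending at x or at z is impossible since both are
        -- neighbours of u₀; one starting at a vertex u of degree 3 would give
        -- u₀ the four neighbours x, w, z, u (or force u = z = u₀ when d = 3).
        u₀-stepFree : StepFree G u₀
        u₀-stepFree u t u≢u₀ t≢u₀ u₀u u₀t step with step-bad step
        ... | inj₁ du≡2 =
          true≢false (trans (sym (adj-sym G x-u₀)) (trans (cong (adj G u₀) (sym t≡x)) u₀t))
          where
            t≡x : t ≡ x
            t≡x = uniqueOfDeg once₁ (suc-injective (trans (sym step) du≡2)) deg-x
        ... | inj₂ (inj₂ du≡w) =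
          true≢false (trans (sym (u₀-z z≢u₀)) (trans (cong (adj G u₀) (sym t≡z)) u₀t))
          where
            t≡z : t ≡ z
            t≡z = uniqueOfDeg onceD (suc-injective (trans (sym step) du≡w)) deg-z
            z≢u₀ : z ≢ u₀
            z≢u₀ z≡u₀ = t≢u₀ (trans t≡z z≡u₀)
        ... | inj₂ (inj₁ du≡3) with z F.≟ u₀
        ...   | yes z≡u₀ = u≢u₀ (trans (uniqueOfDeg onceD du≡d deg-z) z≡u₀)
          where
            du≡d : deg G u ≡ d
            du≡d = trans du≡3 (trans (sym deg-u₀) (trans (cong (deg G) (sym z≡u₀)) deg-z))
        ...   | no z≢u₀ = <-irrefl refl (subst (4 ≤_) deg-u₀
                 (neighbours-bound G u₀ ((x≢w ∷ x≢z ∷ x≢u ∷ []) ∷ (w≢z ∷ w≢u ∷ []) ∷ (z≢u ∷ []) ∷ [] ∷ [])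
                                        (adj-sym G x-u₀ ∷ u₀-w ∷ u₀-z z≢u₀ ∷ u₀u ∷ [])))
          where
            x≢u : x ≢ u
            x≢u = distinctByDeg deg-x du≡3 (λ ())
            w≢u : w ≢ u
            w≢u = distinctByDeg deg-w du≡3 d+1≢3
            z≢u : z ≢ u
            z≢u z≡u = z≢u₀ (sym (uniqueOfDeg onceD (trans deg-u₀ (trans (sym du≡3) (trans (cong (deg G) (sym z≡u)) deg-z))) deg-z))

      reconstructible : DsReconstructible G
      reconstructible with deg G u₀ ℕ.≟ 3
      ... | no du₀≢3 = stepFree⇒reconstructible G x (x-stepFree du₀≢3)
      ... | yes deg-u₀ with adj G b z in bz
      ...   | true  = stepFree⇒reconstructible G b (b-stepFree bz)
      ...   | false = stepFree⇒reconstructible G u₀ (Hub.u₀-stepFree deg-u₀ bz)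

    reconstructible : DsReconstructible G
    reconstructible with deg G x ℕ.≟ 1 | deg G x ℕ.≟ 2
    ... | yes deg-x | _         = Leaf.reconstructible deg-x
    ... | no dx≢1   | yes deg-x = stepFree⇒reconstructible G x (x-stepFree-deg2 deg-x)
    ... | no dx≢1   | no dx≢2   = stepFree⇒reconstructible G w (w-stepFree dx≢1 dx≢2)

  reconstructible : DsReconstructible G
  reconstructible with F.any? (λ x → ¬? (x F.≟ w) ×-dec (adj G w x ≟ᵇ false))
  ... | yes (x , x≢w , wx) = NonNeighbour.reconstructible x x≢w wx
  ... | no dominating =
        stepFree⇒reconstructible G w (λ _ t _ t≢w _ wt _ → dominating (t , t≢w , wt))

mainTheorem16 : (π : List ℕ) (d : ℕ) →
    occ 1 π ≡ 1 → occ 2 π ≡ 1 → occ d π ≡ 1 → occ (suc d) π ≡ 1 →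
    3 ∈ π →
    (∀ x → Bad π x ⇔ (x ≡ 2 ⊎ x ≡ 3 ⊎ x ≡ suc d)) →
    suc d ≢ 2 → suc d ≢ 3 →
    length π ≤ d + 3 →
    DsReconstructionForcing π
mainTheorem16 π d once₁ once₂ onceD onceD+1 _ bad d+1≢2 d+1≢3 short G realizes =
  Forcing.reconstructible π d once₁ once₂ onceD onceD+1 bad d+1≢2 d+1≢3 short G realizes
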